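{- Let $d\ge3$ and $h\ge 3$ be integers, and let $T(d,h)$ be the $d$-regular tree of depth $h$, i.e. the rooted tree in which the root and every other non-leaf vertex have degree $d$ and all leaves are at depth $h$. Then \[ \nu_2(T(d,h))=2\,\frac{(d-1)^h-1}{d-2}. \]
   Context: A $2$-matching of a graph is a set of edges such that every vertex is incident to at most two of them; $\nu_2(G)$ is the maximum size of a $2$-matching of $G$. -}

module Defs where

open import Data.Nat using (ℕ; zero; suc; _≤_; _∸_; NonZero; s≤s; z≤n)
open import Data.Nat.Properties using () renaming (_≟_ to _≟ℕ_)
open import Data.List using (List; []; _∷_; concatMap; upTo; length; lookup)
import Data.List.Properties as LP
open import Data.Product using (_×_; _,_; ∃-syntax)
open import Data.Fin using (Fin)
open import Data.Fin.Subset using (Subset; _∩_; ∣_∣; _∈_)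
open import Data.Vec using (tabulate)
open import Data.Bool using (Bool; true; false; _∨_)
open import Relation.Nullary.Decidable using (⌊_⌋; Dec)
open import Relation.Binary.PropositionalEquality using (_≡_)

-- Vertex addresses in a rooted tree: the root is [], and the
-- i-th child of the vertex with address a has address i ∷ a.
Vertex : Set
Vertex = List ℕ

_≟V_ : (u v : Vertex) → Dec (u ≡ v)
_≟V_ = LP.≡-dec _≟ℕ_

Edge : Set
Edge = Vertex × Vertex

-- A graph is represented by its (duplicate-free) list of edges.
Graph : Set
Graph = List Edge

incident : Vertex → Edge → Bool
incident v (x , y) = ⌊ v ≟V x ⌋ ∨ ⌊ v ≟V y ⌋

incidentSet : (G : Graph) → Vertex → Subset (length G)
incidentSet G v = tabulate (λ i → incident v (lookup G i))

EdgeSet : Graph → Set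
EdgeSet G = Subset (length G)

Is2Matching : (G : Graph) → EdgeSet G → Set
Is2Matching G S = ∀ (v : Vertex) → ∣ S ∩ incidentSet G v ∣ ≤ 2

ν₂≡ : Graph → ℕ → Set
ν₂≡ G k = (∃[ S ] (Is2Matching G S × ∣ S ∣ ≡ k))
        × (∀ (S : EdgeSet G) → Is2Matching G S → ∣ S ∣ ≤ k)

subtreeEdges : ℕ → ℕ → Vertex → List Edge
subtreeEdges b zero    v = []
subtreeEdges b (suc r) v =
  concatMap (λ i → (v , i ∷ v) ∷ subtreeEdges b r (i ∷ v)) (upTo b)

-- T(d,h): the root has d children, every other non-leaf vertex has
-- d - 1 children (hence degree d), and all leaves are at depth h.
T : ℕ → ℕ → Graph
T d zero    = []
T d (suc h) =
  concatMap (λ i → ([] , i ∷ []) ∷ subtreeEdges (d ∸ 1) h (i ∷ [])) (upTo d)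

nz : ∀ d → 3 ≤ d → NonZero (d ∸ 2)
nz (suc (suc (suc d))) _ = _
nz (suc zero) (s≤s ())
nz (suc (suc zero)) (s≤s (s≤s ()))

-- The vertices of odd height (distance to the leaves) form a vertex cover C of T(d,h), since
-- every edge joins two consecutive heights; as each vertex meets at most two edges of a
-- 2-matching, ν₂ ≤ 2|C|. Conversely, joining every vertex of odd height to two of its children
-- gives a 2-matching of size 2|C|: the parent of such a vertex has even height, so it meets no
-- further chosen edge. Finally |C| = 1 + (d-1) + ⋯ + (d-1)^(h-1).
module Submission where

open import Defs
open import Data.Nat using (ℕ; zero; suc; _+_; _*_; _∸_; _^_; _/_; _≤_; _<_; _<ᵇ_; z≤n; s≤s; NonZero)
open import Data.Nat.Properties
open import Data.Nat.DivMod using (m*n/n≡m)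
open import Data.Nat.ListAction using (sum)
open import Data.Nat.ListAction.Properties using (sum-++)
open import Data.Nat.Tactic.RingSolver using (solve-∀)
open import Algebra.Properties.CommutativeSemigroup +-commutativeSemigroup using (interchange)
open import Algebra.Properties.CommutativeSemigroup *-commutativeSemigroup using (x∙yz≈y∙xz)
open import Data.Bool using (Bool; true; false; not; _∧_; if_then_else_)
open import Data.Bool.Properties using (T-∨; T-≡; ¬-not; not-involutive)
open import Data.List using (List; []; _∷_; [_]; _++_; length; map; concatMap; upTo; lookup)
open import Data.List.Properties using (map-cong; map-++; length-++; length-upTo; ++-assoc; ++-cancelʳ; ∷ʳ-injectiveʳ; ++-identityˡ-unique; ++-conicalʳ)
open import Data.List.Relation.Unary.All as All using (All; []; _∷_)
open import Data.List.Relation.Unary.All.Properties using (++⁺; applyUpTo⁺₂)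
open import Data.List.Relation.Unary.Any as Any using (Any; here; there)
open import Data.List.Relation.Unary.Any.Properties using (concatMap⁻)
open import Data.List.Relation.Unary.AllPairs using (_∷_)
open import Data.List.Relation.Unary.Unique.Propositional using (Unique)
open import Data.List.Relation.Unary.Unique.Propositional.Properties using (upTo⁺)
open import Data.List.Relation.Binary.Subset.Propositional using (_⊆_)
open import Data.List.Relation.Binary.Subset.Propositional.Properties using (Any-resp-⊆; ++⁺ʳ; xs⊆xs++ys; xs⊆ys++xs)
open import Data.Fin.Subset using (_∩_; ∣_∣)
open import Data.Vec using (tabulate; []; _∷_)
open import Data.Product using (_,_; ∃-syntax)
open import Data.Sum using (_⊎_; inj₁; inj₂; [_,_]′)
import Data.Sum as Sum
open import Function using (_∘_; id)
open import Function.Bundles using (Equivalence)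
open import Relation.Binary.PropositionalEquality using (_≡_; _≢_; refl; sym; trans; cong; cong₂; subst; module ≡-Reasoning)
open import Relation.Nullary using (¬_; yes; no; contradiction)
open import Relation.Nullary.Decidable using (⌊_⌋; toWitness; fromWitness; toSum)

⟦_⟧ : Bool → ℕ
⟦ true ⟧  = 1
⟦ false ⟧ = 0

⟦⟧≤1 : ∀ a → ⟦ a ⟧ ≤ 1
⟦⟧≤1 true  = ≤-refl
⟦⟧≤1 false = z≤n

⟦∧⟧≤ˡ : ∀ a b → ⟦ a ∧ b ⟧ ≤ ⟦ a ⟧
⟦∧⟧≤ˡ true  b = ⟦⟧≤1 b
⟦∧⟧≤ˡ false b = z≤n

⟦∧⟧≤ʳ : ∀ a b → ⟦ a ∧ b ⟧ ≤ ⟦ b ⟧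
⟦∧⟧≤ʳ true  b = ≤-refl
⟦∧⟧≤ʳ false b = z≤n

⟦not⟧+2*⟦⟧≤2 : ∀ a → ⟦ not a ⟧ + 2 * ⟦ a ⟧ ≤ 2
⟦not⟧+2*⟦⟧≤2 true  = ≤-refl
⟦not⟧+2*⟦⟧≤2 false = s≤s z≤n

module _ {A : Set} where

  count : (A → Bool) → List A → ℕ
  count p = sum ∘ map (⟦_⟧ ∘ p)

  count>0⇒Any : ∀ (p : A → Bool) xs → 0 < count p xs → Any (λ x → p x ≡ true) xs
  count>0⇒Any p (x ∷ xs) pos with p x in px
  ... | true  = here px
  ... | false = there (count>0⇒Any p xs pos)

  Any⇒count>0 : ∀ {p : A → Bool} {xs} → Any (λ x → p x ≡ true) xs → 0 < count p xs
  Any⇒count>0 (here px) rewrite px = s≤s z≤n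
  Any⇒count>0 {p} {x ∷ _} (there any) = ≤-trans (Any⇒count>0 any) (m≤n+m _ ⟦ p x ⟧)

  sum-map-+ : ∀ (f g : A → ℕ) xs → sum (map (λ x → f x + g x) xs) ≡ sum (map f xs) + sum (map g xs)
  sum-map-+ f g []       = refl
  sum-map-+ f g (x ∷ xs) =
    trans (cong (f x + g x +_) (sum-map-+ f g xs)) (interchange (f x) (g x) _ _)

  sum-map-const : ∀ a (xs : List A) → sum (map (λ _ → a) xs) ≡ length xs * a
  sum-map-const a []       = refl
  sum-map-const a (x ∷ xs) = cong (a +_) (sum-map-const a xs)

  sum-map-mono : ∀ {f g : A → ℕ} → (∀ x → f x ≤ g x) → ∀ xs → sum (map f xs) ≤ sum (map g xs)
  sum-map-mono f≤g []       = z≤n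
  sum-map-mono f≤g (x ∷ xs) = +-mono-≤ (f≤g x) (sum-map-mono f≤g xs)

  sum-map-zero : ∀ {f : A → ℕ} {xs} → All (λ x → f x ≡ 0) xs → sum (map f xs) ≡ 0
  sum-map-zero []            = refl
  sum-map-zero (fx≡0 ∷ f≡0) = cong₂ _+_ fx≡0 (sum-map-zero f≡0)

  sum-map-≤-atMostOnePositive : ∀ {f : A → ℕ} {c xs} → Unique xs →
                     (∀ x y → 0 < f x → 0 < f y → x ≡ y) → (∀ x → f x ≤ c) →
                     sum (map f xs) ≤ c
  sum-map-≤-atMostOnePositive {xs = []} _ _ _ = z≤n
  sum-map-≤-atMostOnePositive {f} {c} {x ∷ xs} (x∉xs ∷ unique) single f≤c with f x ≟ 0
  ... | yes fx≡0 rewrite fx≡0 = sum-map-≤-atMostOnePositive unique single f≤c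
  ... | no  fx≢0 = begin
    f x + sum (map f xs) ≡⟨ cong (f x +_) (sum-map-zero (All.map vanishes x∉xs)) ⟩
    f x + 0              ≡⟨ +-identityʳ (f x) ⟩
    f x                  ≤⟨ f≤c x ⟩
    c                    ∎
    where
    open ≤-Reasoning
    vanishes : ∀ {y} → x ≢ y → f y ≡ 0
    vanishes {y} x≢y = n≤0⇒n≡0 (≮⇒≥ (x≢y ∘ single x y (n≢0⇒n>0 fx≢0)))

module _ {A B : Set} where

  sum-map-concatMap : ∀ (g : B → ℕ) (f : A → List B) xs →
                      sum (map g (concatMap f xs)) ≡ sum (map (λ x → sum (map g (f x))) xs)
  sum-map-concatMap g f []       = refl
  sum-map-concatMap g f (x ∷ xs) = begin
    sum (map g (f x ++ concatMap f xs))             ≡⟨ cong sum (map-++ g (f x) _) ⟩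
    sum (map g (f x) ++ map g (concatMap f xs))     ≡⟨ sum-++ (map g (f x)) _ ⟩
    sum (map g (f x)) + sum (map g (concatMap f xs)) ≡⟨ cong (_ +_) (sum-map-concatMap g f xs) ⟩
    sum (map (λ y → sum (map g (f y))) (x ∷ xs))    ∎
    where open ≡-Reasoning

  length-concatMap : ∀ (f : A → List B) xs → length (concatMap f xs) ≡ sum (map (length ∘ f) xs)
  length-concatMap f []       = refl
  length-concatMap f (x ∷ xs) =
    trans (length-++ (f x)) (cong (length (f x) +_) (length-concatMap f xs))

sum-map-const-upTo : ∀ a n → sum (map (λ _ → a) (upTo n)) ≡ n * a
sum-map-const-upTo a n = trans (sum-map-const a (upTo n)) (cong (_* a) (length-upTo n))

sum-firstTwo : ∀ a m → sum (map (λ i → ⟦ (i <ᵇ 2) ∧ a ⟧) (upTo (2 + m))) ≡ 2 * ⟦ a ⟧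
sum-firstTwo a m =
  cong (λ s → ⟦ a ⟧ + (⟦ a ⟧ + s)) (sum-map-zero (applyUpTo⁺₂ _ m (λ _ → refl)))

incident-fst : ∀ x y → incident x (x , y) ≡ true
incident-fst x y = Equivalence.to T-≡ (Equivalence.from T-∨ (inj₁ (fromWitness {a? = x ≟V x} refl)))

incident-snd : ∀ x y → incident y (x , y) ≡ true
incident-snd x y = Equivalence.to T-≡ (Equivalence.from T-∨ (inj₂ (fromWitness {a? = y ≟V y} refl)))

incident⇒endpoint : ∀ {v x y} → incident v (x , y) ≡ true → v ≡ x ⊎ v ≡ y
incident⇒endpoint {v} {x} {y} =
  Sum.map toWitness toWitness ∘ Equivalence.to (T-∨ {⌊ v ≟V x ⌋} {⌊ v ≟V y ⌋}) ∘ Equivalence.from T-≡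

Covers : List Vertex → List Edge → Set
Covers C = All (λ e → Any (λ v → incident v e ≡ true) C)

Covers-mono : ∀ {C C′ L} → C ⊆ C′ → Covers C L → Covers C′ L
Covers-mono C⊆C′ = All.map (Any-resp-⊆ C⊆C′)

Covers-concatMap : ∀ {I : Set} (A : List Vertex) (f : I → List Vertex) (g : I → List Edge) xs →
                   (∀ i → Covers (A ++ f i) (g i)) → Covers (A ++ concatMap f xs) (concatMap g xs)
Covers-concatMap A f g []       cover = []
Covers-concatMap A f g (x ∷ xs) cover =
  ++⁺ (Covers-mono (++⁺ʳ A (xs⊆xs++ys (f x) _)) (cover x))
      (Covers-mono (++⁺ʳ A (xs⊆ys++xs _ (f x))) (Covers-concatMap A f g xs cover))

length≤sum-degree : ∀ C L → Covers C L → length L ≤ sum (map (λ v → count (incident v) L) C)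
length≤sum-degree C []      _                 = z≤n
length≤sum-degree C (e ∷ L) (e-covered ∷ cover) = begin
  1 + length L
    ≤⟨ +-mono-≤ (Any⇒count>0 e-covered) (length≤sum-degree C L cover) ⟩
  count (λ v → incident v e) C + sum (map (λ v → count (incident v) L) C)
    ≡⟨ sum-map-+ (λ v → ⟦ incident v e ⟧) (λ v → count (incident v) L) C ⟨
  sum (map (λ v → count (incident v) (e ∷ L)) C)
    ∎
  where open ≤-Reasoning

selected : (G : Graph) → EdgeSet G → List Edge
selected []      []          = []
selected (e ∷ G) (true ∷ S)  = e ∷ selected G S
selected (e ∷ G) (false ∷ S) = selected G S

∣∣≡length-selected : ∀ G S → ∣ S ∣ ≡ length (selected G S)
∣∣≡length-selected []      []          = refl
∣∣≡length-selected (e ∷ G) (true ∷ S)  = cong suc (∣∣≡length-selected G S)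
∣∣≡length-selected (e ∷ G) (false ∷ S) = ∣∣≡length-selected G S

∣∩incidentSet∣≡count-selected : ∀ G S v → ∣ S ∩ incidentSet G v ∣ ≡ count (incident v) (selected G S)
∣∩incidentSet∣≡count-selected []      []          v = refl
∣∩incidentSet∣≡count-selected (e ∷ G) (true ∷ S)  v with incident v e
... | true  = cong suc (∣∩incidentSet∣≡count-selected G S v)
... | false = ∣∩incidentSet∣≡count-selected G S v
∣∩incidentSet∣≡count-selected (e ∷ G) (false ∷ S) v = ∣∩incidentSet∣≡count-selected G S v

All-selected : ∀ {P : Edge → Set} G S → All P G → All P (selected G S)
All-selected []      []          []       = []
All-selected (e ∷ G) (true ∷ S)  (p ∷ ps) = p ∷ All-selected G S ps
All-selected (e ∷ G) (false ∷ S) (p ∷ ps) = All-selected G S ps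

mask : (Edge → Bool) → (G : Graph) → EdgeSet G
mask p G = tabulate (λ i → p (lookup G i))

∣mask∣≡count : ∀ p G → ∣ mask p G ∣ ≡ count p G
∣mask∣≡count p []      = refl
∣mask∣≡count p (e ∷ G) with p e
... | true  = cong suc (∣mask∣≡count p G)
... | false = ∣mask∣≡count p G

∣mask∩incidentSet∣≡count : ∀ p G v →
  ∣ mask p G ∩ incidentSet G v ∣ ≡ count (λ e → p e ∧ incident v e) G
∣mask∩incidentSet∣≡count p []      v = refl
∣mask∩incidentSet∣≡count p (e ∷ G) v with p e | incident v e
... | true  | true  = cong suc (∣mask∩incidentSet∣≡count p G v)
... | true  | false = ∣mask∩incidentSet∣≡count p G v
... | false | _     = ∣mask∩incidentSet∣≡count p G v

2-matching≤2*cover : ∀ G C → Covers C G → ∀ S → Is2Matching G S → ∣ S ∣ ≤ 2 * length C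
2-matching≤2*cover G C cover S 2-matching = begin
  ∣ S ∣                     ≡⟨ ∣∣≡length-selected G S ⟩
  length (selected G S)     ≤⟨ length≤sum-degree C _ (All-selected G S cover) ⟩
  sum (map (λ v → count (incident v) (selected G S)) C)
    ≤⟨ sum-map-mono (λ v → subst (_≤ 2) (∣∩incidentSet∣≡count-selected G S v) (2-matching v)) C ⟩
  sum (map (λ _ → 2) C)     ≡⟨ sum-map-const 2 C ⟩
  length C * 2              ≡⟨ *-comm (length C) 2 ⟩
  2 * length C              ∎
  where open ≤-Reasoning

ν₂≡-2*cover : ∀ G C (p : Edge → Bool) → Covers C G →
              (∀ v → count (λ e → p e ∧ incident v e) G ≤ 2) → count p G ≡ 2 * length C →
              ν₂≡ G (2 * length C)
ν₂≡-2*cover G C p cover degree≤2 size =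
  (mask p G , is2Matching , trans (∣mask∣≡count p G) size) , 2-matching≤2*cover G C cover
  where
  is2Matching : Is2Matching G (mask p G)
  is2Matching v = subst (_≤ 2) (sym (∣mask∩incidentSet∣≡count p G v)) (degree≤2 v)

_≼_ : Vertex → Vertex → Set
u ≼ v = ∃[ p ] v ≡ p ++ u

≼-parent : ∀ {i u v} → (i ∷ u) ≼ v → u ≼ v
≼-parent {i} {u} (p , refl) = p ++ [ i ] , sym (++-assoc p [ i ] u)

child≼-injective : ∀ {i j w v} → (i ∷ w) ≼ v → (j ∷ w) ≼ v → i ≡ j
child≼-injective {i} {j} {w} (p , refl) (q , eq) = ∷ʳ-injectiveʳ p q (++-cancelʳ w _ _ (begin
  (p ++ [ i ]) ++ w ≡⟨ ++-assoc p [ i ] w ⟩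
  p ++ i ∷ w        ≡⟨ eq ⟩
  q ++ j ∷ w        ≡⟨ ++-assoc q [ j ] w ⟨
  (q ++ [ j ]) ++ w ∎))
  where open ≡-Reasoning

child⋠parent : ∀ {i w} → ¬ (i ∷ w) ≼ w
child⋠parent {i} {w} (p , eq)
  with () ← ++-conicalʳ p [ i ] (++-identityˡ-unique (p ++ [ i ]) (trans eq (sym (++-assoc p [ i ] w))))

odd : ℕ → Bool
odd zero    = false
odd (suc n) = not (odd n)

geomSum : ℕ → ℕ → ℕ
geomSum b zero    = 0
geomSum b (suc r) = 1 + b * geomSum b r

module Tree (b : ℕ) where

  branch : ℕ → Vertex → ℕ → List Edge
  branch r w i = (w , i ∷ w) ∷ subtreeEdges b r (i ∷ w)

  -- w has the children i ∷ w, i < n, each the root of a b-ary tree of depth r; thus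
  -- subtreeEdges b (suc r) w = tree b r w and T (1 + b) (suc h) = tree (1 + b) h [].
  tree : ℕ → ℕ → Vertex → List Edge
  tree n r w = concatMap (branch r w) (upTo n)

  mutual
    incident-branch : ∀ r w i {v} → Any (λ e → incident v e ≡ true) (branch r w i) →
                      v ≡ w ⊎ (i ∷ w) ≼ v
    incident-branch r w i (here v∈e)  = Sum.map₂ ([] ,_) (incident⇒endpoint v∈e)
    incident-branch r w i (there any) = inj₂ (incident-subtree r (i ∷ w) any)

    incident-subtree : ∀ r u {v} → Any (λ e → incident v e ≡ true) (subtreeEdges b r u) → u ≼ v
    incident-subtree (suc r) u any with i , any′ ← Any.satisfied (concatMap⁻ (branch r u) {xs = upTo b} any)
      = [ [] ,_ , ≼-parent ]′ (incident-branch r u i any′)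

  -- The vertices of odd height; the root u of subtreeEdges b r u has height r.
  mutual
    coverSubtree : ℕ → Vertex → List Vertex
    coverSubtree zero    u = []
    coverSubtree (suc r) u = coverTree b r u

    coverTree : ℕ → ℕ → Vertex → List Vertex
    coverTree n r w = (if odd (suc r) then [ w ] else []) ++ concatMap (λ i → coverSubtree r (i ∷ w)) (upTo n)

  parent-edge-covered : ∀ r w i →
    Any (λ v → incident v (w , i ∷ w) ≡ true) ((if odd (suc r) then [ w ] else []) ++ coverSubtree r (i ∷ w))
  parent-edge-covered zero    w i = here (incident-fst w (i ∷ w))
  parent-edge-covered (suc r) w i with odd r
  ... | true  = here (incident-fst w (i ∷ w))
  ... | false = here (incident-snd w (i ∷ w))

  mutual
    coverSubtree-covers : ∀ r u → Covers (coverSubtree r u) (subtreeEdges b r u)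
    coverSubtree-covers zero    u = []
    coverSubtree-covers (suc r) u = coverTree-covers b r u

    coverTree-covers : ∀ n r w → Covers (coverTree n r w) (tree n r w)
    coverTree-covers n r w = Covers-concatMap root (λ i → coverSubtree r (i ∷ w)) (branch r w) (upTo n)
      (λ i → parent-edge-covered r w i ∷ Covers-mono (xs⊆ys++xs _ root) (coverSubtree-covers r (i ∷ w)))
      where
      root : List Vertex
      root = if odd (suc r) then [ w ] else []

  coverCount : ℕ → ℕ
  coverCount zero    = 0
  coverCount (suc r) = ⟦ odd (suc r) ⟧ + b * coverCount r

  mutual
    length-coverSubtree : ∀ r u → length (coverSubtree r u) ≡ coverCount r
    length-coverSubtree zero    u = refl
    length-coverSubtree (suc r) u = length-coverTree b r u

    length-coverTree : ∀ n r w → length (coverTree n r w) ≡ ⟦ odd (suc r) ⟧ + n * coverCount r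
    length-coverTree n r w = begin
      length (root ++ concatMap (λ i → coverSubtree r (i ∷ w)) (upTo n))
        ≡⟨ length-++ root ⟩
      length root + length (concatMap (λ i → coverSubtree r (i ∷ w)) (upTo n))
        ≡⟨ cong₂ _+_ (length-root (odd (suc r))) (length-concatMap (λ i → coverSubtree r (i ∷ w)) (upTo n)) ⟩
      ⟦ odd (suc r) ⟧ + sum (map (λ i → length (coverSubtree r (i ∷ w))) (upTo n))
        ≡⟨ cong (⟦ odd (suc r) ⟧ +_) (cong sum (map-cong (λ i → length-coverSubtree r (i ∷ w)) (upTo n))) ⟩
      ⟦ odd (suc r) ⟧ + sum (map (λ _ → coverCount r) (upTo n))
        ≡⟨ cong (⟦ odd (suc r) ⟧ +_) (sum-map-const-upTo (coverCount r) n) ⟩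
      ⟦ odd (suc r) ⟧ + n * coverCount r
        ∎
      where
      open ≡-Reasoning
      root : List Vertex
      root = if odd (suc r) then [ w ] else []
      length-root : ∀ c → length (if c then [ w ] else []) ≡ ⟦ c ⟧
      length-root true  = refl
      length-root false = refl

  coverCount≡geomSum : ∀ r → ⟦ odd (suc r) ⟧ + suc b * coverCount r ≡ geomSum b (suc r)
  coverCount≡geomSum zero    = cong suc (trans (*-zeroʳ (suc b)) (sym (*-zeroʳ b)))
  coverCount≡geomSum (suc r) =
    trans (step (odd (suc r)) (coverCount r)) (cong (λ s → 1 + b * s) (coverCount≡geomSum r))
    where
    step : ∀ a c → ⟦ not a ⟧ + suc b * (⟦ a ⟧ + b * c) ≡ 1 + b * (⟦ a ⟧ + suc b * c)
    step true  = odd-step b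
      where
      odd-step : ∀ x c → 0 + suc x * (1 + x * c) ≡ 1 + x * (1 + suc x * c)
      odd-step = solve-∀
    step false = even-step b
      where
      even-step : ∀ x c → 1 + suc x * (0 + x * c) ≡ 1 + x * (0 + suc x * c)
      even-step = solve-∀

module TwoMatching (k H : ℕ) where

  b : ℕ
  b = 2 + k

  open Tree b

  -- odd (length w + suc H) is the parity of the height suc H ∸ length w of w in T (1 + b) (suc H).
  oddHeight : Vertex → Bool
  oddHeight w = odd (length w + suc H)

  chosen : Edge → Bool
  chosen (x , [])    = false
  chosen (x , i ∷ _) = (i <ᵇ 2) ∧ oddHeight x

  chosenDegree : Vertex → List Edge → ℕ
  chosenDegree v = count (λ e → chosen e ∧ incident v e)

  child-parity : ∀ r w i → oddHeight w ≡ odd (suc r) → oddHeight (i ∷ w) ≡ odd r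
  child-parity r w i parity = trans (cong not parity) (not-involutive (odd r))

  chosenDegree>0⇒incident : ∀ v L → 0 < chosenDegree v L → Any (λ e → incident v e ≡ true) L
  chosenDegree>0⇒incident v L pos =
    count>0⇒Any (incident v) L (≤-trans pos (sum-map-mono (λ e → ⟦∧⟧≤ʳ (chosen e) (incident v e)) L))

  chosenDegree-root : ∀ m r w → chosenDegree w (tree (2 + m) r w) ≤ 2 * ⟦ oddHeight w ⟧
  chosenDegree-root m r w = begin
    chosenDegree w (tree (2 + m) r w)
      ≡⟨ sum-map-concatMap _ (branch r w) (upTo (2 + m)) ⟩
    sum (map (λ i → chosenDegree w (branch r w i)) (upTo (2 + m)))
      ≤⟨ sum-map-mono parent-edge-only (upTo (2 + m)) ⟩
    sum (map (λ i → ⟦ (i <ᵇ 2) ∧ oddHeight w ⟧) (upTo (2 + m)))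
      ≡⟨ sum-firstTwo (oddHeight w) m ⟩
    2 * ⟦ oddHeight w ⟧
      ∎
    where
    open ≤-Reasoning
    w∉subtree : ∀ i → chosenDegree w (subtreeEdges b r (i ∷ w)) ≡ 0
    w∉subtree i = n≤0⇒n≡0 (≮⇒≥ (child⋠parent ∘ incident-subtree r (i ∷ w) ∘ chosenDegree>0⇒incident w _))
    parent-edge-only : ∀ i → chosenDegree w (branch r w i) ≤ ⟦ (i <ᵇ 2) ∧ oddHeight w ⟧
    parent-edge-only i = begin
      ⟦ chosen (w , i ∷ w) ∧ incident w (w , i ∷ w) ⟧ + chosenDegree w (subtreeEdges b r (i ∷ w))
        ≡⟨ cong (_ +_) (w∉subtree i) ⟩
      ⟦ chosen (w , i ∷ w) ∧ incident w (w , i ∷ w) ⟧ + 0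
        ≡⟨ +-identityʳ _ ⟩
      ⟦ chosen (w , i ∷ w) ∧ incident w (w , i ∷ w) ⟧
        ≤⟨ ⟦∧⟧≤ˡ (chosen (w , i ∷ w)) _ ⟩
      ⟦ (i <ᵇ 2) ∧ oddHeight w ⟧
        ∎

  chosenDegree-subtree-root : ∀ r u → oddHeight u ≡ odd r → chosenDegree u (subtreeEdges b r u) ≤ 2 * ⟦ odd r ⟧
  chosenDegree-subtree-root zero    u _      = z≤n
  chosenDegree-subtree-root (suc r) u parity =
    subst (λ a → chosenDegree u (tree b r u) ≤ 2 * ⟦ a ⟧) parity (chosenDegree-root k r u)

  mutual
    chosenDegree-subtree≤2 : ∀ r u → oddHeight u ≡ odd r → ∀ v → chosenDegree v (subtreeEdges b r u) ≤ 2
    chosenDegree-subtree≤2 zero    u _      v = z≤n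
    chosenDegree-subtree≤2 (suc r) u parity v = chosenDegree-tree≤2 k r u parity v

    chosenDegree-tree≤2 : ∀ m r w → oddHeight w ≡ odd (suc r) → ∀ v → chosenDegree v (tree (2 + m) r w) ≤ 2
    chosenDegree-tree≤2 m r w parity v = [ at-root , chosenDegree-nonroot≤2 m r w parity ]′ (toSum (v ≟V w))
      where
      at-root : v ≡ w → chosenDegree v (tree (2 + m) r w) ≤ 2
      at-root refl = ≤-trans (chosenDegree-root m r w) (*-monoʳ-≤ 2 (⟦⟧≤1 (oddHeight w)))

    -- A vertex other than w lies below at most one child of w.
    chosenDegree-nonroot≤2 : ∀ m r w → oddHeight w ≡ odd (suc r) →
                             ∀ {v} → v ≢ w → chosenDegree v (tree (2 + m) r w) ≤ 2
    chosenDegree-nonroot≤2 m r w parity {v} v≢w = begin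
      chosenDegree v (tree (2 + m) r w)
        ≡⟨ sum-map-concatMap _ (branch r w) (upTo (2 + m)) ⟩
      sum (map (λ i → chosenDegree v (branch r w i)) (upTo (2 + m)))
        ≤⟨ sum-map-≤-atMostOnePositive (upTo⁺ (2 + m)) same-branch
             (λ i → chosenDegree-branch≤2 r w i parity v≢w) ⟩
      2 ∎
      where
      open ≤-Reasoning
      below : ∀ i → 0 < chosenDegree v (branch r w i) → (i ∷ w) ≼ v
      below i pos =
        [ (λ v≡w → contradiction v≡w v≢w) , id ]′ (incident-branch r w i (chosenDegree>0⇒incident v _ pos))
      same-branch : ∀ i j → 0 < chosenDegree v (branch r w i) → 0 < chosenDegree v (branch r w j) → i ≡ j
      same-branch i j pos-i pos-j = child≼-injective (below i pos-i) (below j pos-j)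

    chosenDegree-branch≤2 : ∀ r w i → oddHeight w ≡ odd (suc r) →
                            ∀ {v} → v ≢ w → chosenDegree v (branch r w i) ≤ 2
    chosenDegree-branch≤2 r w i parity {v} v≢w = [ at-child , off-child ]′ (toSum (v ≟V (i ∷ w)))
      where
      -- The parent edge is chosen only if w has odd height, and then the child has even height.
      at-child : v ≡ i ∷ w → chosenDegree v (branch r w i) ≤ 2
      at-child refl = begin
        ⟦ chosen (w , i ∷ w) ∧ incident (i ∷ w) (w , i ∷ w) ⟧ + chosenDegree (i ∷ w) (subtreeEdges b r (i ∷ w))
          ≤⟨ +-mono-≤ (≤-trans (⟦∧⟧≤ˡ (chosen (w , i ∷ w)) _) (⟦∧⟧≤ʳ (i <ᵇ 2) (oddHeight w)))
                      (chosenDegree-subtree-root r (i ∷ w) (child-parity r w i parity)) ⟩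
        ⟦ oddHeight w ⟧ + 2 * ⟦ odd r ⟧
          ≡⟨ cong (λ a → ⟦ a ⟧ + 2 * ⟦ odd r ⟧) parity ⟩
        ⟦ not (odd r) ⟧ + 2 * ⟦ odd r ⟧
          ≤⟨ ⟦not⟧+2*⟦⟧≤2 (odd r) ⟩
        2 ∎
        where open ≤-Reasoning
      off-child : v ≢ i ∷ w → chosenDegree v (branch r w i) ≤ 2
      off-child v≢iw = ≤-trans (+-monoˡ-≤ _ parent-edge-absent)
                               (chosenDegree-subtree≤2 r (i ∷ w) (child-parity r w i parity) v)
        where
        parent-edge-absent : ⟦ chosen (w , i ∷ w) ∧ incident v (w , i ∷ w) ⟧ ≤ 0
        parent-edge-absent = ≤-trans (⟦∧⟧≤ʳ (chosen (w , i ∷ w)) _)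
          (≤-reflexive (cong ⟦_⟧ (¬-not ([ v≢w , v≢iw ]′ ∘ incident⇒endpoint))))

  mutual
    count-chosen-subtree : ∀ r u → oddHeight u ≡ odd r → count chosen (subtreeEdges b r u) ≡ 2 * coverCount r
    count-chosen-subtree zero    u _      = refl
    count-chosen-subtree (suc r) u parity = count-chosen-tree k r u parity

    count-chosen-tree : ∀ m r w → oddHeight w ≡ odd (suc r) →
                        count chosen (tree (2 + m) r w) ≡ 2 * (⟦ odd (suc r) ⟧ + (2 + m) * coverCount r)
    count-chosen-tree m r w parity = begin
      count chosen (tree n r w)
        ≡⟨ sum-map-concatMap _ (branch r w) (upTo n) ⟩
      sum (map (λ i → ⟦ (i <ᵇ 2) ∧ oddHeight w ⟧ + count chosen (subtreeEdges b r (i ∷ w))) (upTo n))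
        ≡⟨ sum-map-+ (λ i → ⟦ (i <ᵇ 2) ∧ oddHeight w ⟧) (λ i → count chosen (subtreeEdges b r (i ∷ w))) (upTo n) ⟩
      sum (map (λ i → ⟦ (i <ᵇ 2) ∧ oddHeight w ⟧) (upTo n))
        + sum (map (λ i → count chosen (subtreeEdges b r (i ∷ w))) (upTo n))
        ≡⟨ cong₂ _+_ (sum-firstTwo (oddHeight w) m)
                     (cong sum (map-cong (λ i → count-chosen-subtree r (i ∷ w) (child-parity r w i parity)) (upTo n))) ⟩
      2 * ⟦ oddHeight w ⟧ + sum (map (λ _ → 2 * coverCount r) (upTo n))
        ≡⟨ cong₂ _+_ (cong (λ a → 2 * ⟦ a ⟧) parity) (sum-map-const-upTo (2 * coverCount r) n) ⟩
      2 * ⟦ odd (suc r) ⟧ + n * (2 * coverCount r)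
        ≡⟨ cong (2 * ⟦ odd (suc r) ⟧ +_) (x∙yz≈y∙xz n 2 (coverCount r)) ⟩
      2 * ⟦ odd (suc r) ⟧ + 2 * (n * coverCount r)
        ≡⟨ *-distribˡ-+ 2 ⟦ odd (suc r) ⟧ (n * coverCount r) ⟨
      2 * (⟦ odd (suc r) ⟧ + n * coverCount r)
        ∎
      where
      open ≡-Reasoning
      n : ℕ
      n = 2 + m

geomSum-closed : ∀ a r → geomSum (suc a) r * a + 1 ≡ suc a ^ r
geomSum-closed a zero    = refl
geomSum-closed a (suc r) = trans (step a (geomSum (suc a) r)) (cong (suc a *_) (geomSum-closed a r))
  where
  step : ∀ a s → (1 + suc a * s) * a + 1 ≡ suc a * (s * a + 1)
  step = solve-∀

*geomSum≡/ : ∀ c a .{{_ : NonZero a}} r → c * geomSum (suc a) r ≡ (c * (suc a ^ r ∸ 1)) / a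
*geomSum≡/ c a r = sym (begin
  (c * (suc a ^ r ∸ 1)) / a ≡⟨ cong (λ x → (c * (x ∸ 1)) / a) (geomSum-closed a r) ⟨
  (c * (s * a + 1 ∸ 1)) / a ≡⟨ cong (λ x → (c * x) / a) (m+n∸n≡m (s * a) 1) ⟩
  (c * (s * a)) / a         ≡⟨ cong (_/ a) (*-assoc c s a) ⟨
  (c * s * a) / a           ≡⟨ m*n/n≡m (c * s) a ⟩
  c * s                     ∎)
  where
  open ≡-Reasoning
  s : ℕ
  s = geomSum (suc a) r

ν₂≡-T : ∀ k h → ν₂≡ (T (3 + k) h) (2 * geomSum (2 + k) h)
ν₂≡-T k zero    = ν₂≡-2*cover [] [] (λ _ → false) [] (λ _ → z≤n) refl
ν₂≡-T k (suc H) = subst (ν₂≡ (tree d H [])) (cong (2 *_) |C|≡geomSum)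
  (ν₂≡-2*cover (tree d H []) C chosen (coverTree-covers d H []) (chosenDegree-tree≤2 (suc k) H [] refl) count≡)
  where
  open Tree (2 + k)
  open TwoMatching k H
  d : ℕ
  d = 3 + k
  C : List Vertex
  C = coverTree d H []
  |C|≡geomSum : length C ≡ geomSum (2 + k) (suc H)
  |C|≡geomSum = trans (length-coverTree d H []) (coverCount≡geomSum H)
  count≡ : count chosen (tree d H []) ≡ 2 * length C
  count≡ = trans (count-chosen-tree (suc k) H [] refl) (cong (2 *_) (sym (length-coverTree d H [])))

corollary5p5 : ∀ (d h : ℕ) (hd : 3 ≤ d) → 3 ≤ h →
    ν₂≡ (T d h) (_/_ (2 * ((d ∸ 1) ^ h ∸ 1)) (d ∸ 2) {{nz d hd}})
corollary5p5 (suc (suc (suc k))) h _ _ = subst (ν₂≡ (T (3 + k) h)) (*geomSum≡/ 2 (suc k) h) (ν₂≡-T k h)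
corollary5p5 0                   h () _
corollary5p5 1                   h (s≤s ()) _
corollary5p5 2                   h (s≤s (s≤s ())) _
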